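{- Let $P=(r,E)$ be a polymatroid. Then (i) $\lambda_{P^*}=\lambda_P$; (ii) $P^*$ is compact; (iii) $(P^*)^*=P^\flat$.
   Context: A polymatroid $P=(r,E)$ is a finite set $E$ with a function $r:2^E\to\mathbb{R}$ that is normalised ($r(\emptyset)=0$), submodular and increasing. Its connectivity function is $\lambda_P(X)=r(X)+r(E-X)-r(E)$. For $X\subseteq E$, $\|X\|_r=\sum_{x\in X}r(\{x\})$. The dual of $P$ is $P^*=(r^*,E)$ with $r^*(X)=r(E-X)+\|X\|_r-r(E)$ (this is a polymatroid). An element $e$ of a polymatroid $Q=(s,E)$ is compact if $s(\{e\})=\lambda_Q(\{e\})$, and $Q$ is compact if all its elements are compact. The compactification of $P$ is $P^\flat=(r^\flat,E)$ where $r^\flat(X)=r(X)+\sum_{x\in X}(\lambda_P(\{x\})-r(\{x\}))$ for all $X\subseteq E$. -}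

module Defs where

open import Level using (Level; _⊔_; suc)
open import Data.Nat using (ℕ)
open import Data.Bool using (true; false)
open import Data.Fin using (Fin)
open import Data.Fin.Subset using (Subset; ⊥; _∪_; _∩_; ∁; ⁅_⁆; _⊆_)
open import Data.Vec using (lookup)
open import Data.List using (List; foldr; allFin)
open import Data.Product using (_×_)
open import Algebra.Bundles using (CommutativeRing)
open import Relation.Binary.Structures using (IsTotalOrder)

-- The standard library has no real numbers.  We work over an arbitrary
-- ordered commutative ring (ℝ being the intended instance).
record OrderedCommRing (c ℓ₁ ℓ₂ : Level) : Set (suc (c ⊔ ℓ₁ ⊔ ℓ₂)) where
  field
    commRing : CommutativeRing c ℓ₁
  open CommutativeRing commRing public
  field
    _≤_          : Carrier → Carrier → Set ℓ₂
    isTotalOrder : IsTotalOrder _≈_ _≤_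
    +-mono-≤     : ∀ {x y} z → x ≤ y → (x + z) ≤ (y + z)
    *-nonneg     : ∀ {x y} → 0# ≤ x → 0# ≤ y → 0# ≤ (x * y)

module Poly {c ℓ₁ ℓ₂} (R : OrderedCommRing c ℓ₁ ℓ₂) (n : ℕ) where
  open OrderedCommRing R

  SetFn : Set c
  SetFn = Subset n → Carrier

  record IsPolymatroid (r : SetFn) : Set (ℓ₁ ⊔ ℓ₂) where
    field
      normalised  : r ⊥ ≈ 0#
      submodular  : ∀ X Y → (r (X ∪ Y) + r (X ∩ Y)) ≤ (r X + r Y)
      increasing  : ∀ X Y → X ⊆ Y → r X ≤ r Y

  sumOver : Subset n → (Fin n → Carrier) → Carrier
  sumOver X f = foldr step 0# (allFin n)
    where
      step : Fin n → Carrier → Carrier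
      step i acc with lookup X i
      ... | true  = f i + acc
      ... | false = acc

  E : Subset n
  E = ∁ ⊥

  conn : SetFn → SetFn
  conn r X = r X + r (∁ X) - r E

  norm : SetFn → Subset n → Carrier
  norm r X = sumOver X (λ x → r ⁅ x ⁆)

  dual : SetFn → SetFn
  dual r X = r (∁ X) + norm r X - r E

  IsCompactElem : SetFn → Fin n → Set ℓ₁
  IsCompactElem s e = s ⁅ e ⁆ ≈ conn s ⁅ e ⁆

  IsCompact : SetFn → Set ℓ₁
  IsCompact s = ∀ e → IsCompactElem s e

  flat : SetFn → SetFn
  flat r X = r X + sumOver X (λ x → conn r ⁅ x ⁆ - r ⁅ x ⁆)

-- Only the normalisation r(∅) = 0 of the polymatroid is needed.  Since
-- ‖X‖ + ‖E − X‖ = ‖E‖ and r*(E) = ‖E‖ − r(E), expanding the definitions gives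
-- r*(X) + r*(E − X) = λ(X) + r*(E), which is (i).  Directly r*({e}) = λ({e}),
-- which with (i) is (ii).  By (ii), ‖X‖_{r*} = Σ_{x∈X} λ({x}), and expanding
-- again gives r*(E − X) + ‖X‖_{r*} = r♭(X) + r*(E), which is (iii).
module Submission where

open import Defs
open import Data.Nat using (ℕ)
import Data.Nat as ℕ
open import Data.Fin.Subset using (Subset; ⊥; ⊤; ∁; ⁅_⁆)
open import Data.Product using (_×_; _,_)

open import Algebra.Bundles using (AbelianGroup)
import Algebra.Properties.AbelianGroup as AbelianGroupProperties
import Algebra.Properties.CommutativeSemigroup as CommutativeSemigroupProperties
import Algebra.Properties.Group as GroupProperties
import Algebra.Solver.CommutativeMonoid as CommutativeMonoidSolver
open import Data.Bool using (true; false; not; if_then_else_)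
open import Data.Bool.Properties using (not-involutive)
open import Data.Fin using (Fin; zero; suc)
open import Data.List using (foldr; allFin)
import Data.List as List
open import Data.List.Properties using (foldr-cong)
open import Data.Vec using ([]; _∷_; lookup)
import Data.Vec as Vec
open import Data.Vec.Properties using (tabulate∘lookup; map-replicate)
open import Function using (_∘_; id)
open import Relation.Binary.PropositionalEquality as ≡ using (_≡_)
import Relation.Binary.Reasoning.Setoid as SetoidReasoning

∁-involutive : ∀ {m} (X : Subset m) → ∁ (∁ X) ≡ X
∁-involutive []      = ≡.refl
∁-involutive (b ∷ X) = ≡.cong₂ _∷_ (not-involutive b) (∁-involutive X)

∁⊥≡⊤ : ∀ {m} → ∁ ⊥ ≡ ⊤ {m}
∁⊥≡⊤ {m} = map-replicate not false m

module SubsetSum {a ℓ} (G : AbelianGroup a ℓ) where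
  open AbelianGroup G
  open SetoidReasoning setoid
  open AbelianGroupProperties G using (⁻¹-∙-comm; ε⁻¹≈ε)
  open CommutativeSemigroupProperties commutativeSemigroup using (interchange; x∙yz≈y∙xz)

  ∑ : ∀ {m} → Subset m → (Fin m → Carrier) → Carrier
  ∑ []      f = ε
  ∑ (b ∷ X) f = if b then f zero ∙ ∑ X (f ∘ suc) else ∑ X (f ∘ suc)

  foldr-tabulate≡∑ : ∀ {m k} (Y : Subset k) (f : Fin k → Carrier) (g : Fin m → Fin k) →
    foldr (λ i acc → if lookup Y i then f i ∙ acc else acc) ε (List.tabulate g)
      ≡ ∑ (Vec.tabulate (lookup Y ∘ g)) (f ∘ g)
  foldr-tabulate≡∑ {ℕ.zero}  Y f g = ≡.refl
  foldr-tabulate≡∑ {ℕ.suc m} Y f g =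
    ≡.cong (λ acc → if lookup Y (g zero) then f (g zero) ∙ acc else acc)
           (foldr-tabulate≡∑ Y f (g ∘ suc))

  ∑-cong : ∀ {m} (X : Subset m) {f g : Fin m → Carrier} → (∀ i → f i ≈ g i) → ∑ X f ≈ ∑ X g
  ∑-cong []          f≈g = refl
  ∑-cong (true ∷ X)  f≈g = ∙-cong (f≈g zero) (∑-cong X (f≈g ∘ suc))
  ∑-cong (false ∷ X) f≈g = ∑-cong X (f≈g ∘ suc)

  ∑-⊥ : ∀ {m} (f : Fin m → Carrier) → ∑ ⊥ f ≈ ε
  ∑-⊥ {ℕ.zero}  f = refl
  ∑-⊥ {ℕ.suc m} f = ∑-⊥ (f ∘ suc)

  ∑-⁅⁆ : ∀ {m} (e : Fin m) (f : Fin m → Carrier) → ∑ ⁅ e ⁆ f ≈ f e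
  ∑-⁅⁆ zero    f = trans (∙-congˡ (∑-⊥ (f ∘ suc))) (identityʳ (f zero))
  ∑-⁅⁆ (suc e) f = ∑-⁅⁆ e (f ∘ suc)

  ∑-∁ : ∀ {m} (X : Subset m) (f : Fin m → Carrier) → ∑ X f ∙ ∑ (∁ X) f ≈ ∑ ⊤ f
  ∑-∁ []          f = identityˡ ε
  ∑-∁ (true ∷ X)  f = trans (assoc _ _ _) (∙-congˡ (∑-∁ X (f ∘ suc)))
  ∑-∁ (false ∷ X) f = trans (x∙yz≈y∙xz _ _ _) (∙-congˡ (∑-∁ X (f ∘ suc)))

  ∑-∙ : ∀ {m} (X : Subset m) (f g : Fin m → Carrier) → ∑ X (λ i → f i ∙ g i) ≈ ∑ X f ∙ ∑ X g
  ∑-∙ []          f g = sym (identityˡ ε)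
  ∑-∙ (true ∷ X)  f g = trans (∙-congˡ (∑-∙ X (f ∘ suc) (g ∘ suc))) (interchange _ _ _ _)
  ∑-∙ (false ∷ X) f g = ∑-∙ X (f ∘ suc) (g ∘ suc)

  ∑-⁻¹ : ∀ {m} (X : Subset m) (f : Fin m → Carrier) → ∑ X (λ i → f i ⁻¹) ≈ ∑ X f ⁻¹
  ∑-⁻¹ []          f = sym ε⁻¹≈ε
  ∑-⁻¹ (true ∷ X)  f = trans (∙-congˡ (∑-⁻¹ X (f ∘ suc))) (⁻¹-∙-comm _ _)
  ∑-⁻¹ (false ∷ X) f = ∑-⁻¹ X (f ∘ suc)

module Duality {c ℓ₁ ℓ₂} (R : OrderedCommRing c ℓ₁ ℓ₂) (n : ℕ) where
  open OrderedCommRing R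
  open Poly R n
  open SubsetSum +-abelianGroup
  open SetoidReasoning setoid
  open GroupProperties +-group using (//-rightDividesˡ; //-rightDividesʳ)
  open CommutativeMonoidSolver +-commutativeMonoid using (solve; _⊜_; _⊕_)

  mutual
    sumOver≡∑ : ∀ X f → sumOver X f ≡ ∑ X f
    sumOver≡∑ X f =
      ≡.trans (foldr-cong (sumOver-step X f) ≡.refl (allFin n))
        (≡.trans (foldr-tabulate≡∑ X f id) (≡.cong (λ Y → ∑ Y f) (tabulate∘lookup X)))

    -- The `_` is the local step function of sumOver, which cannot be named
    -- outside its where block; it is solved from the use above.
    sumOver-step : ∀ X f i acc → _ ≡ (if lookup X i then f i + acc else acc)
    sumOver-step X f i acc with lookup X i
    ... | true  = ≡.refl
    ... | false = ≡.refl

  sumOver-cong : ∀ X {f g} → (∀ i → f i ≈ g i) → sumOver X f ≈ sumOver X g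
  sumOver-cong X {f} {g} f≈g = begin
    sumOver X f ≡⟨ sumOver≡∑ X f ⟩
    ∑ X f       ≈⟨ ∑-cong X f≈g ⟩
    ∑ X g       ≡⟨ sumOver≡∑ X g ⟨
    sumOver X g ∎

  sumOver-⁅⁆ : ∀ e f → sumOver ⁅ e ⁆ f ≈ f e
  sumOver-⁅⁆ e f = trans (reflexive (sumOver≡∑ ⁅ e ⁆ f)) (∑-⁅⁆ e f)

  sumOver-∁ : ∀ X f → sumOver X f + sumOver (∁ X) f ≈ sumOver E f
  sumOver-∁ X f = begin
    sumOver X f + sumOver (∁ X) f ≡⟨ ≡.cong₂ _+_ (sumOver≡∑ X f) (sumOver≡∑ (∁ X) f) ⟩
    ∑ X f + ∑ (∁ X) f             ≈⟨ ∑-∁ X f ⟩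
    ∑ ⊤ f                         ≡⟨ ≡.cong (λ Y → ∑ Y f) ∁⊥≡⊤ ⟨
    ∑ E f                         ≡⟨ sumOver≡∑ E f ⟨
    sumOver E f                   ∎

  sumOver-sub : ∀ X f g → sumOver X (λ i → f i - g i) ≈ sumOver X f - sumOver X g
  sumOver-sub X f g = begin
    sumOver X (λ i → f i - g i) ≡⟨ sumOver≡∑ X _ ⟩
    ∑ X (λ i → f i - g i)       ≈⟨ ∑-∙ X f (λ i → - g i) ⟩
    ∑ X f + ∑ X (λ i → - g i)   ≈⟨ +-congˡ (∑-⁻¹ X g) ⟩
    ∑ X f - ∑ X g               ≡⟨ ≡.cong₂ _-_ (sumOver≡∑ X f) (sumOver≡∑ X g) ⟨
    sumOver X f - sumOver X g   ∎

  norm-∁ : ∀ r X → norm r X + norm r (∁ X) ≈ norm r E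
  norm-∁ r X = sumOver-∁ X (λ x → r ⁅ x ⁆)

  dual-∁ : ∀ r X → dual r (∁ X) ≈ r X + norm r (∁ X) - r E
  dual-∁ r X = +-congʳ (+-congʳ (reflexive (≡.cong r (∁-involutive X))))

  dual-E : ∀ r → r ⊥ ≈ 0# → ∀ X → dual r E ≈ (norm r X + norm r (∁ X)) - r E
  dual-E r r⊥≈0 X = +-congʳ (begin
    r (∁ E) + norm r E       ≡⟨ ≡.cong (λ Y → r Y + norm r E) (∁-involutive ⊥) ⟩
    r ⊥ + norm r E           ≈⟨ +-congʳ r⊥≈0 ⟩
    0# + norm r E            ≈⟨ +-identityˡ (norm r E) ⟩
    norm r E                 ≈⟨ norm-∁ r X ⟨
    norm r X + norm r (∁ X)  ∎)

  dual-⁅⁆ : ∀ r e → dual r ⁅ e ⁆ ≈ conn r ⁅ e ⁆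
  dual-⁅⁆ r e = +-congʳ (trans (+-congˡ (sumOver-⁅⁆ e (λ x → r ⁅ x ⁆))) (+-comm _ _))

  dual-+-dual-∁ : ∀ r → r ⊥ ≈ 0# → ∀ X → dual r X + dual r (∁ X) ≈ conn r X + dual r E
  dual-+-dual-∁ r r⊥≈0 X = begin
    dual r X + dual r (∁ X)
      ≈⟨ +-congˡ (dual-∁ r X) ⟩
    (r (∁ X) + norm r X - r E) + (r X + norm r (∁ X) - r E)
      ≈⟨ solve 5 (λ q a p b t → ((q ⊕ a) ⊕ t) ⊕ ((p ⊕ b) ⊕ t) ⊜ ((p ⊕ q) ⊕ t) ⊕ ((a ⊕ b) ⊕ t)) refl
           (r (∁ X)) (norm r X) (r X) (norm r (∁ X)) (- r E) ⟩
    conn r X + ((norm r X + norm r (∁ X)) - r E)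
      ≈⟨ +-congˡ (dual-E r r⊥≈0 X) ⟨
    conn r X + dual r E ∎

  conn-dual : ∀ r → r ⊥ ≈ 0# → ∀ X → conn (dual r) X ≈ conn r X
  conn-dual r r⊥≈0 X =
    trans (+-congʳ (dual-+-dual-∁ r r⊥≈0 X)) (//-rightDividesʳ (dual r E) (conn r X))

  dual-compact : ∀ r → r ⊥ ≈ 0# → IsCompact (dual r)
  dual-compact r r⊥≈0 e = trans (dual-⁅⁆ r e) (sym (conn-dual r r⊥≈0 ⁅ e ⁆))

  norm-dual : ∀ r X → norm (dual r) X ≈ sumOver X (λ x → conn r ⁅ x ⁆ - r ⁅ x ⁆) + norm r X
  norm-dual r X = begin
    norm (dual r) X                                       ≈⟨ sumOver-cong X (dual-⁅⁆ r) ⟩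
    sumOver X (λ x → conn r ⁅ x ⁆)                        ≈⟨ //-rightDividesˡ (norm r X) _ ⟨
    sumOver X (λ x → conn r ⁅ x ⁆) - norm r X + norm r X  ≈⟨ +-congʳ (sumOver-sub X _ _) ⟨
    sumOver X (λ x → conn r ⁅ x ⁆ - r ⁅ x ⁆) + norm r X   ∎

  dual-∁-+-norm-dual : ∀ r → r ⊥ ≈ 0# → ∀ X → dual r (∁ X) + norm (dual r) X ≈ flat r X + dual r E
  dual-∁-+-norm-dual r r⊥≈0 X = begin
    dual r (∁ X) + norm (dual r) X
      ≈⟨ +-cong (dual-∁ r X) (norm-dual r X) ⟩
    (r X + norm r (∁ X) - r E) + (F + norm r X)
      ≈⟨ solve 5 (λ p b t f a → ((p ⊕ b) ⊕ t) ⊕ (f ⊕ a) ⊜ (p ⊕ f) ⊕ ((a ⊕ b) ⊕ t)) refl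
           (r X) (norm r (∁ X)) (- r E) F (norm r X) ⟩
    flat r X + ((norm r X + norm r (∁ X)) - r E)
      ≈⟨ +-congˡ (dual-E r r⊥≈0 X) ⟨
    flat r X + dual r E ∎
    where
    F : Carrier
    F = sumOver X (λ x → conn r ⁅ x ⁆ - r ⁅ x ⁆)

  dual-dual : ∀ r → r ⊥ ≈ 0# → ∀ X → dual (dual r) X ≈ flat r X
  dual-dual r r⊥≈0 X =
    trans (+-congʳ (dual-∁-+-norm-dual r r⊥≈0 X)) (//-rightDividesʳ (dual r E) (flat r X))

lemma3p4 : ∀ {c ℓ₁ ℓ₂} (R : OrderedCommRing c ℓ₁ ℓ₂) (n : ℕ) (r : Subset n → OrderedCommRing.Carrier R) →
    Poly.IsPolymatroid R n r →
    (∀ X → OrderedCommRing._≈_ R (Poly.conn R n (Poly.dual R n r) X) (Poly.conn R n r X))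
    × Poly.IsCompact R n (Poly.dual R n r)
    × (∀ X → OrderedCommRing._≈_ R (Poly.dual R n (Poly.dual R n r) X) (Poly.flat R n r X))
lemma3p4 R n r isPolymatroid =
  conn-dual r normalised , dual-compact r normalised , dual-dual r normalised
  where
  open Duality R n
  open Poly.IsPolymatroid isPolymatroid using (normalised)
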